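{- For any graph $G=(V,E)$ with at least one edge, $$\min_{S\subset V,\ E(S)\neq\emptyset}\frac{|S|-1}{|E(S)|}=\min_{\emptyset\neq F\subset E}\frac{|V(F)|-c(F)}{|F|}.$$
   Context: $E(S)=E\cap(S\times S)$ is the set of edges with both endpoints in $S$. For $F\subset E$, $V(F)$ is the set of endpoints of edges in $F$, and $c(F)$ is the number of connected components of the graph $(V(F),F)$. -}

module Defs where

open import Data.Nat using (ℕ; zero; suc; _∸_; _≤ᵇ_; _<_)
open import Data.Bool using (Bool; true; false; _∧_; _∨_; if_then_else_)
open import Data.Fin using (Fin; toℕ)
open import Data.Fin.Properties using (_≟_)
open import Data.Fin.Subset using (Subset; ∣_∣; Nonempty; _∈_)
open import Data.Vec using (lookup; tabulate)
open import Data.Product using (_×_; proj₁; proj₂; ∃; _,_)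
open import Data.Sum using (_⊎_)
open import Data.Integer using (+_)
open import Data.Rational.Unnormalised using (ℚᵘ; mkℚᵘ; _≃_; _≤_)
open import Relation.Binary.PropositionalEquality using (_≡_; _≢_)
open import Relation.Nullary.Decidable using (⌊_⌋)

record Graph : Set where
  field
    n    : ℕ
    m    : ℕ
    ends : Fin m → Fin n × Fin n
    loopless : ∀ e → proj₁ (ends e) ≢ proj₂ (ends e)
    simple   : ∀ e f →
      ((proj₁ (ends e) ≡ proj₁ (ends f) × proj₂ (ends e) ≡ proj₂ (ends f))
       ⊎ (proj₁ (ends e) ≡ proj₂ (ends f) × proj₂ (ends e) ≡ proj₁ (ends f)))
      → e ≡ f

anyFin : ∀ {k} → (Fin k → Bool) → Bool
anyFin {zero}  p = false
anyFin {suc k} p = p Fin.zero ∨ anyFin (λ i → p (Fin.suc i))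

allFin : ∀ {k} → (Fin k → Bool) → Bool
allFin {zero}  p = true
allFin {suc k} p = p Fin.zero ∧ allFin (λ i → p (Fin.suc i))

toSubset : ∀ {k} → (Fin k → Bool) → Subset k
toSubset p = tabulate p

_∈ᵇ_ : ∀ {k} → Fin k → Subset k → Bool
i ∈ᵇ p = lookup p i

module _ (G : Graph) where
  open Graph G

  E[_] : Subset n → Subset m
  E[ S ] = toSubset (λ e → (proj₁ (ends e) ∈ᵇ S) ∧ (proj₂ (ends e) ∈ᵇ S))

  V[_] : Subset m → Subset n
  V[ F ] = toSubset (λ v → anyFin (λ e → (e ∈ᵇ F) ∧
             (⌊ proj₁ (ends e) ≟ v ⌋ ∨ ⌊ proj₂ (ends e) ≟ v ⌋)))

  adjF : Subset m → Fin n → Fin n → Bool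
  adjF F u v = anyFin (λ e → (e ∈ᵇ F) ∧
     ((⌊ proj₁ (ends e) ≟ u ⌋ ∧ ⌊ proj₂ (ends e) ≟ v ⌋) ∨
      (⌊ proj₁ (ends e) ≟ v ⌋ ∧ ⌊ proj₂ (ends e) ≟ u ⌋)))

  reachWithin : Subset m → ℕ → Fin n → Fin n → Bool
  reachWithin F zero    u v = ⌊ u ≟ v ⌋
  reachWithin F (suc k) u v =
    reachWithin F k u v ∨ anyFin (λ w → reachWithin F k u w ∧ adjF F w v)

  -- connectivity in (V(F), F): walks of length ≤ n suffice
  connected : Subset m → Fin n → Fin n → Bool
  connected F = reachWithin F n

  -- c(F): number of connected components of (V(F), F), counted as the
  -- number of v ∈ V(F) that have the least index in their component
  c[_] : Subset m → ℕ
  c[ F ] = ∣ toSubset (λ v → (v ∈ᵇ V[ F ]) ∧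
              allFin (λ u → if connected F u v then toℕ v ≤ᵇ toℕ u else true)) ∣

-- a / b as an (unnormalised) rational, intended for b ≥ 1
frac : ℕ → ℕ → ℚᵘ
frac a b = mkℚᵘ (+ a) (b ∸ 1)

IsMin : {X : Set} → (X → Set) → (X → ℚᵘ) → ℚᵘ → Set
IsMin {X} P f q = (∃ λ x → P x × (f x ≃ q)) × (∀ x → P x → q ≤ f x)

-- Let S* minimise (|S| - 1) / |E(S)|, with value a / b.  For any nonempty F, split F and
-- V(F) along the components of (V(F), F): a component with vertex set Sᵣ carries only
-- edges of E(Sᵣ), so a·|Fᵣ| ≤ (|Sᵣ| - 1)·b, and summing over the c(F) components gives
-- a·|F| ≤ (|V(F)| - c(F))·b.  Conversely F = E(S*) has V(F) ⊆ S* and c(F) ≥ 1, so its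
-- ratio is at most a / b.  Connectivity is reachability by walks of length at most n; it
-- is transitive because the set reachable within k steps can grow only n times.
module Submission where

open import Data.Bool using (Bool; true; false; _∧_; _∨_; if_then_else_)
open import Data.Bool.Properties using (∧-zeroʳ; T-≡; ¬-not; not-¬) renaming (_≟_ to _≟ᵇ_)
open import Data.Empty using (⊥-elim)
open import Data.Fin using (Fin; zero; suc; toℕ)
open import Data.Fin.Properties using (_≟_; toℕ-injective; any?)
open import Data.Fin.Subset using (Subset; ∣_∣; Nonempty; _∈_; _⊆_; ⊤)
open import Data.Fin.Subset.Properties using (p⊆q⇒∣p∣≤∣q∣; p⊂q⇒∣p∣<∣q∣; ∣p∣≤n; x∈p⇒∣p-x∣<∣p∣; x∈⁅y⁆⇔x≡y; ∣⁅x⁆∣≡1; ∈⊤; nonempty?)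
open import Data.Integer as ℤ using (+≤+)
open import Data.Integer.Properties using (pos-*)
open import Data.Nat using (ℕ; zero; suc; _+_; _*_; _∸_; _≤_; _<_; _≤′_; ≤′-reflexive; ≤′-step; z≤n; s≤s; _≤ᵇ_)
open import Data.Nat.Properties hiding (_≟_; ≤-totalPreorder)
open import Algebra.Properties.Semiring.Sum +-*-semiring using (sum; sum-syntax; ∑-comm; ∑-distrib-+; sum-cong-≗; sum-replicate-zero; *-distribˡ-sum; *-distribʳ-sum)
open import Data.Product using (_×_; _,_; proj₁; proj₂; ∃)
open import Data.Rational.Unnormalised using (ℚᵘ; *≤*) renaming (_≤_ to _≤ℚ_)
open import Data.Rational.Unnormalised.Properties using (≤-totalPreorder) renaming (≤-antisym to ≤ℚ-antisym; ≃-refl to ≃ℚ-refl)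
open import Data.Sum using (_⊎_; inj₁; inj₂)
open import Data.Vec using ([]; _∷_; lookup; tabulate)
open import Data.Vec.Properties using (lookup∘tabulate; tabulate∘lookup; tabulate-cong; []=⇒lookup; lookup⇒[]=)
open import Function.Bundles using (Equivalence)
open import Relation.Binary.Bundles using (TotalPreorder)
open import Relation.Binary.PropositionalEquality
open import Relation.Nullary using (¬_; yes; no)
open import Relation.Nullary.Decidable using (⌊_⌋; _×-dec_)
open import Relation.Unary using (Decidable)
open import Defs

open Equivalence using (to; from)

∧-true : ∀ {a b} → a ≡ true → b ≡ true → a ∧ b ≡ true
∧-true refl refl = refl

∧-trueˡ : ∀ a {b} → a ∧ b ≡ true → a ≡ true
∧-trueˡ true _ = refl

∧-trueʳ : ∀ a {b} → a ∧ b ≡ true → b ≡ true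
∧-trueʳ true p = p

∨-trueˡ : ∀ {a} b → a ≡ true → a ∨ b ≡ true
∨-trueˡ b refl = refl

∨-trueʳ : ∀ a {b} → b ≡ true → a ∨ b ≡ true
∨-trueʳ true  _ = refl
∨-trueʳ false p = p

∨-true⁻ : ∀ a {b} → a ∨ b ≡ true → a ≡ true ⊎ b ≡ true
∨-true⁻ true  _ = inj₁ refl
∨-true⁻ false p = inj₂ p

if-true : ∀ c {b} → (c ≡ true → b ≡ true) → (if c then b else true) ≡ true
if-true true  h = h refl
if-true false h = refl

if-true⁻ : ∀ c {b} → (if c then b else true) ≡ true → c ≡ true → b ≡ true
if-true⁻ true p _ = p

≟-true : ∀ {k} {i j : Fin k} → i ≡ j → ⌊ i ≟ j ⌋ ≡ true
≟-true {i = i} {j} i≡j with i ≟ j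
... | yes _   = refl
... | no i≢j = ⊥-elim (i≢j i≡j)

≟-true⁻ : ∀ {k} {i j : Fin k} → ⌊ i ≟ j ⌋ ≡ true → i ≡ j
≟-true⁻ {i = i} {j} p with i ≟ j
... | yes i≡j = i≡j

anyFin-true : ∀ {k} (p : Fin k → Bool) i → p i ≡ true → anyFin p ≡ true
anyFin-true p zero    pi = ∨-trueˡ _ pi
anyFin-true p (suc i) pi = ∨-trueʳ (p zero) (anyFin-true (λ j → p (suc j)) i pi)

anyFin-true⁻ : ∀ {k} (p : Fin k → Bool) → anyFin p ≡ true → ∃ λ i → p i ≡ true
anyFin-true⁻ {suc k} p q with ∨-true⁻ (p zero) q
... | inj₁ p0 = zero , p0
... | inj₂ ps with anyFin-true⁻ (λ j → p (suc j)) ps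
...   | i , pi = suc i , pi

allFin-true : ∀ {k} (p : Fin k → Bool) → (∀ i → p i ≡ true) → allFin p ≡ true
allFin-true {zero}  p h = refl
allFin-true {suc k} p h = ∧-true (h zero) (allFin-true (λ j → p (suc j)) (λ j → h (suc j)))

allFin-true⁻ : ∀ {k} (p : Fin k → Bool) → allFin p ≡ true → ∀ i → p i ≡ true
allFin-true⁻ p q zero    = ∧-trueˡ (p zero) q
allFin-true⁻ p q (suc i) = allFin-true⁻ (λ j → p (suc j)) (∧-trueʳ (p zero) q) i

least-witness : ∀ {k} (p : Fin k → Bool) i → p i ≡ true →
  ∃ λ r → p r ≡ true × (∀ u → p u ≡ true → toℕ r ≤ toℕ u)
least-witness p zero p0 = zero , p0 , λ _ _ → z≤n
least-witness p (suc i) pi with p zero in p0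
... | true  = zero , p0 , λ _ _ → z≤n
... | false with least-witness (λ j → p (suc j)) i pi
...   | r , pr , least = suc r , pr , λ
  { zero    pu → ⊥-elim (not-¬ p0 pu)
  ; (suc u) pu → s≤s (least u pu) }

∑-mono-≤ : ∀ {k} {f g : Fin k → ℕ} → (∀ i → f i ≤ g i) → sum f ≤ sum g
∑-mono-≤ {zero}  h = z≤n
∑-mono-≤ {suc k} h = +-mono-≤ (h zero) (∑-mono-≤ (λ i → h (suc i)))

indicator : Bool → ℕ
indicator true  = 1
indicator false = 0

count : ∀ {k} → (Fin k → Bool) → ℕ
count p = ∣ toSubset p ∣

∈-toSubset : ∀ {k} {p : Fin k → Bool} {i} → p i ≡ true → i ∈ toSubset p
∈-toSubset {p = p} {i} pi = lookup⇒[]= i (toSubset p) (trans (lookup∘tabulate p i) pi)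

∈-toSubset⁻ : ∀ {k} {p : Fin k → Bool} {i} → i ∈ toSubset p → p i ≡ true
∈-toSubset⁻ {p = p} {i} i∈p = trans (sym (lookup∘tabulate p i)) ([]=⇒lookup i∈p)

toSubset-⊆ : ∀ {k} {p q : Fin k → Bool} → (∀ i → p i ≡ true → q i ≡ true) → toSubset p ⊆ toSubset q
toSubset-⊆ p⇒q i∈p = ∈-toSubset (p⇒q _ (∈-toSubset⁻ i∈p))

count-mono : ∀ {k} {p q : Fin k → Bool} → (∀ i → p i ≡ true → q i ≡ true) → count p ≤ count q
count-mono p⇒q = p⊆q⇒∣p∣≤∣q∣ (toSubset-⊆ p⇒q)

count-mono-< : ∀ {k} {p q : Fin k → Bool} → (∀ i → p i ≡ true → q i ≡ true) →
  ∀ i → q i ≡ true → p i ≡ false → count p < count q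
count-mono-< p⇒q i qi pi =
  p⊂q⇒∣p∣<∣q∣ (toSubset-⊆ p⇒q , i , ∈-toSubset qi , λ i∈p → not-¬ pi (∈-toSubset⁻ i∈p))

count-cong : ∀ {k} {p q : Fin k → Bool} → (∀ i → p i ≡ q i) → count p ≡ count q
count-cong p≗q = cong ∣_∣ (tabulate-cong p≗q)

count≡∣∣ : ∀ {k} (S : Subset k) → count (lookup S) ≡ ∣ S ∣
count≡∣∣ S = cong ∣_∣ (tabulate∘lookup S)

nonempty⇒∣p∣>0 : ∀ {k} {S : Subset k} → Nonempty S → 0 < ∣ S ∣
nonempty⇒∣p∣>0 (i , i∈S) = ≤-trans (s≤s z≤n) (x∈p⇒∣p-x∣<∣p∣ i∈S)

count>0 : ∀ {k} {p : Fin k → Bool} i → p i ≡ true → 0 < count p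
count>0 i pi = nonempty⇒∣p∣>0 (i , ∈-toSubset pi)

count≡1 : ∀ {k} {p : Fin k → Bool} i → p i ≡ true → (∀ j → p j ≡ true → j ≡ i) → count p ≡ 1
count≡1 {p = p} i pi unique = ≤-antisym
  (≤-trans (p⊆q⇒∣p∣≤∣q∣ (λ j∈p → from x∈⁅y⁆⇔x≡y (unique _ (∈-toSubset⁻ j∈p))))
           (≤-reflexive (∣⁅x⁆∣≡1 i)))
  (count>0 i pi)

count≡∑ : ∀ {k} (p : Fin k → Bool) → count p ≡ ∑[ i < k ] indicator (p i)
count≡∑ {zero}  p = refl
count≡∑ {suc k} p with p zero
... | true  = cong suc (count≡∑ (λ i → p (suc i)))
... | false = count≡∑ (λ i → p (suc i))

count-none : ∀ {k} {p : Fin k → Bool} → (∀ i → p i ≡ false) → count p ≡ 0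
count-none {k} {p} none = begin
  count p                     ≡⟨ count≡∑ p ⟩
  ∑[ i < k ] indicator (p i)  ≡⟨ sum-cong-≗ (λ i → cong indicator (none i)) ⟩
  ∑[ i < k ] 0                ≡⟨ sum-replicate-zero k ⟩
  0                           ∎
  where open ≡-Reasoning

count-partition : ∀ {a b} (g : Fin a → Bool) (K : Fin b → Fin a → Bool) →
  (∀ x → g x ≡ true → count (λ r → K r x) ≡ 1) →
  count g ≡ ∑[ r < b ] count (λ x → g x ∧ K r x)
count-partition {a} {b} g K unique = begin
  count g                                            ≡⟨ count≡∑ g ⟩
  ∑[ x < a ] indicator (g x)                         ≡⟨ sum-cong-≗ split ⟨
  ∑[ x < a ] ∑[ r < b ] indicator (g x ∧ K r x)      ≡⟨ ∑-comm (λ x r → indicator (g x ∧ K r x)) ⟩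
  ∑[ r < b ] ∑[ x < a ] indicator (g x ∧ K r x)      ≡⟨ sum-cong-≗ (λ r → count≡∑ (λ x → g x ∧ K r x)) ⟨
  ∑[ r < b ] count (λ x → g x ∧ K r x)               ∎
  where
  open ≡-Reasoning
  split : ∀ x → ∑[ r < b ] indicator (g x ∧ K r x) ≡ indicator (g x)
  split x with g x in gx
  ... | true  = trans (sym (count≡∑ (λ r → K r x))) (unique x gx)
  ... | false = sum-replicate-zero b

*≤*⇒frac≤frac : ∀ {a b c d} → 0 < b → 0 < d → a * d ≤ c * b → frac a b ≤ℚ frac c d
*≤*⇒frac≤frac {a} {suc b} {c} {suc d} _ _ ad≤cb =
  *≤* (subst₂ ℤ._≤_ (pos-* a (suc d)) (pos-* c (suc b)) (+≤+ ad≤cb))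

frac≤frac⇒*≤* : ∀ {a b c d} → 0 < b → 0 < d → frac a b ≤ℚ frac c d → a * d ≤ c * b
frac≤frac⇒*≤* {a} {suc b} {c} {suc d} _ _ (*≤* le)
  with subst₂ ℤ._≤_ (sym (pos-* a (suc d))) (sym (pos-* c (suc b))) le
... | +≤+ ad≤cb = ad≤cb

[m∸1]*n+n≡m*n : ∀ {m} n → 0 < m → (m ∸ 1) * n + n ≡ m * n
[m∸1]*n+n≡m*n {suc m} n _ = +-comm (m * n) n

module _ {c ℓ₁ ℓ₂} (O : TotalPreorder c ℓ₁ ℓ₂) where
  open TotalPreorder O using (Carrier; _≲_) renaming (refl to ≲-refl; trans to ≲-trans; total to ≲-total)

  argmin-Subset : ∀ n (P : Subset n → Set) → Decidable P → (f : Subset n → Carrier) →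
    (∀ S → ¬ P S) ⊎ (∃ λ S → P S × ∀ T → P T → f S ≲ f T)
  argmin-Subset zero P P? f with P? []
  ... | yes p = inj₂ ([] , p , λ { [] _ → ≲-refl })
  ... | no ¬p = inj₁ λ { [] → ¬p }
  argmin-Subset (suc n) P P? f
    with argmin-Subset n (λ S → P (true ∷ S)) (λ S → P? (true ∷ S)) (λ S → f (true ∷ S))
       | argmin-Subset n (λ S → P (false ∷ S)) (λ S → P? (false ∷ S)) (λ S → f (false ∷ S))
  ... | inj₁ ¬in | inj₁ ¬out = inj₁ λ { (true ∷ S) → ¬in S ; (false ∷ S) → ¬out S }
  ... | inj₁ ¬in | inj₂ (S , pS , min) =
    inj₂ (false ∷ S , pS , λ { (true ∷ T) pT → ⊥-elim (¬in T pT) ; (false ∷ T) pT → min T pT })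
  ... | inj₂ (S , pS , min) | inj₁ ¬out =
    inj₂ (true ∷ S , pS , λ { (true ∷ T) pT → min T pT ; (false ∷ T) pT → ⊥-elim (¬out T pT) })
  ... | inj₂ (S , pS , minS) | inj₂ (S′ , pS′ , minS′) with ≲-total (f (true ∷ S)) (f (false ∷ S′))
  ...   | inj₁ S≲S′ = inj₂ (true ∷ S , pS ,
            λ { (true ∷ T) pT → minS T pT ; (false ∷ T) pT → ≲-trans S≲S′ (minS′ T pT) })
  ...   | inj₂ S′≲S = inj₂ (false ∷ S′ , pS′ ,
            λ { (true ∷ T) pT → ≲-trans S′≲S (minS T pT) ; (false ∷ T) pT → minS′ T pT })

module _ (G : Graph) where
  open Graph G

  src tgt : Fin m → Fin n
  src e = proj₁ (ends e)
  tgt e = proj₂ (ends e)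

  ∈E[_] : ∀ S {e} → lookup S (src e) ≡ true → lookup S (tgt e) ≡ true → e ∈ E[_] G S
  ∈E[ S ] s t = ∈-toSubset {p = λ e → (src e ∈ᵇ S) ∧ (tgt e ∈ᵇ S)} (∧-true s t)

  module Components (F : Subset m) where
    inF : Fin m → Bool
    inF e = e ∈ᵇ F

    inV : Fin n → Bool
    inV v = lookup (V[_] G F) v

    adj : Fin n → Fin n → Bool
    adj = adjF G F

    reach : ℕ → Fin n → Fin n → Bool
    reach = reachWithin G F

    conn : Fin n → Fin n → Bool
    conn = connected G F

    Joins : Fin m → Fin n → Fin n → Set
    Joins e u v = (src e ≡ u × tgt e ≡ v) ⊎ (src e ≡ v × tgt e ≡ u)

    adj-true : ∀ {u v} e → inF e ≡ true → Joins e u v → adj u v ≡ true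
    adj-true e e∈F (inj₁ (s , t)) =
      anyFin-true _ e (∧-true e∈F (∨-trueˡ _ (∧-true (≟-true s) (≟-true t))))
    adj-true e e∈F (inj₂ (s , t)) =
      anyFin-true _ e (∧-true e∈F (∨-trueʳ _ (∧-true (≟-true s) (≟-true t))))

    adj-true⁻ : ∀ {u v} → adj u v ≡ true → ∃ λ e → inF e ≡ true × Joins e u v
    adj-true⁻ {u} {v} uv with anyFin-true⁻ _ uv
    ... | e , q with ∨-true⁻ (⌊ src e ≟ u ⌋ ∧ ⌊ tgt e ≟ v ⌋) (∧-trueʳ (inF e) q)
    ...   | inj₁ r = e , ∧-trueˡ (inF e) q , inj₁ (≟-true⁻ (∧-trueˡ _ r) , ≟-true⁻ (∧-trueʳ _ r))
    ...   | inj₂ r = e , ∧-trueˡ (inF e) q , inj₂ (≟-true⁻ (∧-trueˡ _ r) , ≟-true⁻ (∧-trueʳ _ r))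

    adj-sym : ∀ {u v} → adj u v ≡ true → adj v u ≡ true
    adj-sym uv with adj-true⁻ uv
    ... | e , e∈F , inj₁ st = adj-true e e∈F (inj₂ st)
    ... | e , e∈F , inj₂ st = adj-true e e∈F (inj₁ st)

    adj-edge : ∀ e → inF e ≡ true → adj (src e) (tgt e) ≡ true
    adj-edge e e∈F = adj-true e e∈F (inj₁ (refl , refl))

    inV-true : ∀ {v} e → inF e ≡ true → src e ≡ v ⊎ tgt e ≡ v → inV v ≡ true
    inV-true {v} e e∈F end = trans (lookup∘tabulate _ v) (anyFin-true _ e (∧-true e∈F (endpoint end)))
      where
      endpoint : src e ≡ v ⊎ tgt e ≡ v → ⌊ src e ≟ v ⌋ ∨ ⌊ tgt e ≟ v ⌋ ≡ true
      endpoint (inj₁ s) = ∨-trueˡ _ (≟-true s)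
      endpoint (inj₂ t) = ∨-trueʳ _ (≟-true t)

    inV-true⁻ : ∀ {v} → inV v ≡ true → ∃ λ e → inF e ≡ true × (src e ≡ v ⊎ tgt e ≡ v)
    inV-true⁻ {v} p with anyFin-true⁻ _ (trans (sym (lookup∘tabulate _ v)) p)
    ... | e , q with ∨-true⁻ ⌊ src e ≟ v ⌋ (∧-trueʳ (inF e) q)
    ...   | inj₁ s = e , ∧-trueˡ (inF e) q , inj₁ (≟-true⁻ s)
    ...   | inj₂ t = e , ∧-trueˡ (inF e) q , inj₂ (≟-true⁻ t)

    adj⇒inV : ∀ {u v} → adj u v ≡ true → inV v ≡ true
    adj⇒inV uv with adj-true⁻ uv
    ... | e , e∈F , inj₁ (_ , t) = inV-true e e∈F (inj₂ t)
    ... | e , e∈F , inj₂ (s , _) = inV-true e e∈F (inj₁ s)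

    -- Walks in (V(F), F)
    reach-refl : ∀ k u → reach k u u ≡ true
    reach-refl zero    u = ≟-true refl
    reach-refl (suc k) u = ∨-trueˡ _ (reach-refl k u)

    reach-suc : ∀ {k u v} → reach k u v ≡ true → reach (suc k) u v ≡ true
    reach-suc = ∨-trueˡ _

    reach-step : ∀ {k u w v} → reach k u w ≡ true → adj w v ≡ true → reach (suc k) u v ≡ true
    reach-step {k} {u} {w} {v} uw wv = ∨-trueʳ (reach k u v) (anyFin-true _ w (∧-true uw wv))

    reach-suc⁻ : ∀ {k u v} → reach (suc k) u v ≡ true →
      reach k u v ≡ true ⊎ ∃ λ w → reach k u w ≡ true × adj w v ≡ true
    reach-suc⁻ {k} {u} {v} p with ∨-true⁻ (reach k u v) p
    ... | inj₁ uv = inj₁ uv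
    ... | inj₂ q with anyFin-true⁻ _ q
    ...   | w , r = inj₂ (w , ∧-trueˡ _ r , ∧-trueʳ (reach k u w) r)

    reach-mono : ∀ {j k u v} → j ≤′ k → reach j u v ≡ true → reach k u v ≡ true
    reach-mono (≤′-reflexive refl) p = p
    reach-mono (≤′-step {k} j≤k)   p = reach-suc {k} (reach-mono j≤k p)

    reach-++ : ∀ {j k u v w} → reach j u v ≡ true → reach k v w ≡ true → reach (k + j) u w ≡ true
    reach-++ {k = zero} uv vw with ≟-true⁻ vw
    ... | refl = uv
    reach-++ {j} {suc k} {u} {v} {w} uv vw with reach-suc⁻ {k} vw
    ... | inj₁ vw′            = reach-suc {k + j} (reach-++ {j} {k} uv vw′)
    ... | inj₂ (x , vx , xw) = reach-step {k + j} (reach-++ {j} {k} {u} {v} {x} uv vx) xw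

    reach-sym : ∀ {k u v} → reach k u v ≡ true → reach k v u ≡ true
    reach-sym {zero} uv with ≟-true⁻ uv
    ... | refl = uv
    reach-sym {suc k} {u} {v} uv with reach-suc⁻ {k} uv
    ... | inj₁ uv′            = reach-suc {k} (reach-sym {k} uv′)
    ... | inj₂ (w , uw , wv) = subst (λ i → reach i v u ≡ true) (+-comm k 1)
      (reach-++ {1} {k} (reach-step {0} (reach-refl 0 v) (adj-sym wv)) (reach-sym {k} uw))

    reach⇒inV : ∀ {k u v} → reach k u v ≡ true → u ≢ v → inV v ≡ true
    reach⇒inV {zero}  uv u≢v = ⊥-elim (u≢v (≟-true⁻ uv))
    reach⇒inV {suc k} uv u≢v with reach-suc⁻ {k} uv
    ... | inj₁ uv′          = reach⇒inV {k} uv′ u≢v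
    ... | inj₂ (_ , _ , wv) = adj⇒inV wv

    module _ (u : Fin n) where
      Stable : ℕ → Set
      Stable j = ∀ v → reach (suc j) u v ≡ true → reach j u v ≡ true

      stable⇒reach≤ : ∀ {j} → Stable j → ∀ k v → reach k u v ≡ true → reach j u v ≡ true
      stable⇒reach≤ {j} stable zero v uv with ≟-true⁻ uv
      ... | refl = reach-refl j u
      stable⇒reach≤ {j} stable (suc k) v uv with reach-suc⁻ {k} uv
      ... | inj₁ uv′            = stable⇒reach≤ {j} stable k v uv′
      ... | inj₂ (w , uw , wv) = stable v (reach-step {j} (stable⇒reach≤ {j} stable k w uw) wv)

      stable-or-growing : ∀ k → (∃ λ j → j ≤ k × Stable j) ⊎ k < count (reach k u)
      stable-or-growing zero = inj₂ (count>0 u (reach-refl 0 u))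
      stable-or-growing (suc k) with stable-or-growing k
      ... | inj₁ (j , j≤k , stable) = inj₁ (j , m≤n⇒m≤1+n j≤k , stable)
      ... | inj₂ k<count with any? (λ v → (reach (suc k) u v ≟ᵇ true) ×-dec (reach k u v ≟ᵇ false))
      ...   | yes (v , new , old) =
        inj₂ (≤-trans (s≤s k<count) (count-mono-< (λ w → reach-suc {k}) v new old))
      ...   | no ¬new = inj₁ (k , n≤1+n k , kept)
        where
        kept : Stable k
        kept v new with reach k u v ≟ᵇ true
        ... | yes old  = old
        ... | no ¬old = ⊥-elim (¬new (v , new , ¬-not ¬old))

      reach⇒conn : ∀ k {v} → reach k u v ≡ true → conn u v ≡ true
      reach⇒conn k {v} uv with stable-or-growing n
      ... | inj₁ (j , j≤n , stable) = reach-mono {j} (≤⇒≤′ j≤n) (stable⇒reach≤ {j} stable k v uv)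
      ... | inj₂ n<count             = ⊥-elim (<⇒≱ n<count (∣p∣≤n (toSubset (reach n u))))

    conn-refl : ∀ u → conn u u ≡ true
    conn-refl = reach-refl n

    conn-sym : ∀ {u v} → conn u v ≡ true → conn v u ≡ true
    conn-sym = reach-sym {n}

    conn-trans : ∀ {u v w} → conn u v ≡ true → conn v w ≡ true → conn u w ≡ true
    conn-trans {u} uv vw = reach⇒conn u (n + n) (reach-++ {n} {n} uv vw)

    conn-step : ∀ {u v w} → conn u v ≡ true → adj v w ≡ true → conn u w ≡ true
    conn-step {u} uv vw = reach⇒conn u (suc n) (reach-step {n} uv vw)

    conn⇒inV : ∀ {u v} → conn u v ≡ true → u ≢ v → inV v ≡ true
    conn⇒inV = reach⇒inV {n}

    conn-inV : ∀ {u v} → inV u ≡ true → conn u v ≡ true → inV v ≡ true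
    conn-inV {u} {v} u∈V uv with u ≟ v
    ... | yes refl = u∈V
    ... | no u≢v   = conn⇒inV uv u≢v

    -- The predicate counted by c[_], verbatim, so that c[ F ] is count isRep by definition.
    isRep : Fin n → Bool
    isRep v = (v ∈ᵇ V[_] G F) ∧ allFin (λ u → if conn u v then toℕ v ≤ᵇ toℕ u else true)

    isRep-true⁻ : ∀ {r} → isRep r ≡ true → inV r ≡ true × (∀ u → conn u r ≡ true → toℕ r ≤ toℕ u)
    isRep-true⁻ {r} p = ∧-trueˡ (inV r) p , λ u ur →
      ≤ᵇ⇒≤ (toℕ r) (toℕ u) (from T-≡ (if-true⁻ (conn u r) (allFin-true⁻ _ (∧-trueʳ (inV r) p) u) ur))

    isRep-true : ∀ {r} → inV r ≡ true → (∀ u → conn u r ≡ true → toℕ r ≤ toℕ u) → isRep r ≡ true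
    isRep-true {r} r∈V least =
      ∧-true r∈V (allFin-true _ (λ u → if-true (conn u r) (λ ur → to T-≡ (≤⇒≤ᵇ (least u ur)))))

    rep-exists : ∀ {v} → inV v ≡ true → ∃ λ r → isRep r ≡ true × conn r v ≡ true
    rep-exists {v} v∈V with least-witness (λ u → conn u v) v (conn-refl v)
    ... | r , rv , least =
      r , isRep-true (conn-inV v∈V (conn-sym rv)) (λ u ur → least u (conn-trans ur rv)) , rv

    rep-unique : ∀ {r r′ v} → isRep r ≡ true → isRep r′ ≡ true →
      conn r v ≡ true → conn r′ v ≡ true → r′ ≡ r
    rep-unique {r} {r′} r-rep r′-rep rv r′v =
      toℕ-injective (≤-antisym (proj₂ (isRep-true⁻ r′-rep) r rr′)
                               (proj₂ (isRep-true⁻ r-rep) r′ (conn-sym rr′)))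
      where
      rr′ : conn r r′ ≡ true
      rr′ = conn-trans rv (conn-sym r′v)

    count-reps : ∀ {v} → inV v ≡ true → count (λ r → isRep r ∧ conn r v) ≡ 1
    count-reps v∈V with rep-exists v∈V
    ... | r , r-rep , rv =
      count≡1 r (∧-true r-rep rv) λ r′ p →
        rep-unique r-rep (∧-trueˡ (isRep r′) p) rv (∧-trueʳ (isRep r′) p)

    c>0 : Nonempty F → 0 < c[_] G F
    c>0 (e , e∈F) with rep-exists (inV-true e ([]=⇒lookup e∈F) (inj₁ refl))
    ... | r , r-rep , _ = count>0 r r-rep

    -- Counting F and V(F) component by component
    component : Fin n → Subset n
    component r = toSubset (conn r)

    ∈component : ∀ {r v} → conn r v ≡ true → lookup (component r) v ≡ true
    ∈component {r} {v} rv = trans (lookup∘tabulate (conn r) v) rv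

    component-spans : ∀ {r} → inV r ≡ true → Nonempty (E[_] G (component r))
    component-spans {r} r∈V with inV-true⁻ r∈V
    ... | e , e∈F , end = e , ∈E[ component r ] (∈component (src-conn end)) (∈component (tgt-conn end))
      where
      edge : adj (src e) (tgt e) ≡ true
      edge = adj-edge e e∈F
      src-conn : src e ≡ r ⊎ tgt e ≡ r → conn r (src e) ≡ true
      src-conn (inj₁ refl) = conn-refl r
      src-conn (inj₂ refl) = conn-step (conn-refl r) (adj-sym edge)
      tgt-conn : src e ≡ r ⊎ tgt e ≡ r → conn r (tgt e) ≡ true
      tgt-conn (inj₁ refl) = conn-step (conn-refl r) edge
      tgt-conn (inj₂ refl) = conn-refl r

    edgesOf verticesOf : Fin n → ℕ
    edgesOf r    = count (λ e → inF e ∧ (isRep r ∧ conn r (src e)))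
    verticesOf r = count (λ v → inV v ∧ (isRep r ∧ conn r v))

    edgesOf≤ : ∀ r → edgesOf r ≤ ∣ E[_] G (component r) ∣
    edgesOf≤ r = count-mono λ e p →
      let e∈F = ∧-trueˡ (inF e) p
          rs  = ∧-trueʳ (isRep r) (∧-trueʳ (inF e) p)
      in ∧-true (∈component rs) (∈component (conn-step rs (adj-edge e e∈F)))

    verticesOf-rep : ∀ {r} → isRep r ≡ true → verticesOf r ≡ ∣ component r ∣
    verticesOf-rep {r} r-rep = count-cong within
      where
      within : ∀ v → inV v ∧ (isRep r ∧ conn r v) ≡ conn r v
      within v rewrite r-rep with conn r v in rv
      ... | true  = ∧-true (conn-inV (proj₁ (isRep-true⁻ r-rep)) rv) refl
      ... | false = ∧-zeroʳ (inV v)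

    edgesOf-nonrep : ∀ {r} → isRep r ≡ false → edgesOf r ≡ 0
    edgesOf-nonrep {r} r-nonrep = count-none λ e →
      trans (cong (λ x → inF e ∧ (x ∧ conn r (src e))) r-nonrep) (∧-zeroʳ (inF e))

    edges-partition : ∣ F ∣ ≡ ∑[ r < n ] edgesOf r
    edges-partition = trans (sym (count≡∣∣ F))
      (count-partition inF (λ r e → isRep r ∧ conn r (src e))
        (λ e e∈F → count-reps (inV-true e e∈F (inj₁ refl))))

    vertices-partition : ∣ V[_] G F ∣ ≡ ∑[ r < n ] verticesOf r
    vertices-partition = trans (sym (count≡∣∣ (V[_] G F)))
      (count-partition inV (λ r v → isRep r ∧ conn r v) (λ v → count-reps))

    module _ (a b : ℕ) (sparse : ∀ S → Nonempty (E[_] G S) → a * ∣ E[_] G S ∣ ≤ (∣ S ∣ ∸ 1) * b) where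

      rep-bound : ∀ {r} → isRep r ≡ true → a * edgesOf r + b ≤ verticesOf r * b
      rep-bound {r} r-rep = begin
        a * edgesOf r + b                   ≤⟨ +-monoˡ-≤ b (*-monoʳ-≤ a (edgesOf≤ r)) ⟩
        a * ∣ E[_] G (component r) ∣ + b    ≤⟨ +-monoˡ-≤ b (sparse (component r) (component-spans r∈V)) ⟩
        (∣ component r ∣ ∸ 1) * b + b       ≡⟨ [m∸1]*n+n≡m*n b (count>0 r (conn-refl r)) ⟩
        ∣ component r ∣ * b                 ≡⟨ cong (_* b) (verticesOf-rep r-rep) ⟨
        verticesOf r * b                    ∎
        where
        open ≤-Reasoning
        r∈V : inV r ≡ true
        r∈V = proj₁ (isRep-true⁻ r-rep)

      component-bound : ∀ r → a * edgesOf r + indicator (isRep r) * b ≤ verticesOf r * b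
      component-bound r = by-cases (isRep r) refl
        where
        by-cases : ∀ x → isRep r ≡ x → a * edgesOf r + indicator x * b ≤ verticesOf r * b
        by-cases true  r-rep    =
          subst (λ y → a * edgesOf r + y ≤ verticesOf r * b) (sym (+-identityʳ b)) (rep-bound r-rep)
        by-cases false r-nonrep = ≤-trans (≤-reflexive no-edges) z≤n
          where
          no-edges : a * edgesOf r + 0 ≡ 0
          no-edges = trans (+-identityʳ _) (trans (cong (a *_) (edgesOf-nonrep r-nonrep)) (*-zeroʳ a))

      density-bound : a * ∣ F ∣ ≤ (∣ V[_] G F ∣ ∸ c[_] G F) * b
      density-bound = subst (a * ∣ F ∣ ≤_) (sym (*-distribʳ-∸ b ∣ V[_] G F ∣ (c[_] G F)))
        (m+n≤o⇒m≤o∸n (a * ∣ F ∣) (begin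
          a * ∣ F ∣ + c[_] G F * b
            ≡⟨ cong₂ (λ x y → a * x + y * b) edges-partition (count≡∑ isRep) ⟩
          a * (∑[ r < n ] edgesOf r) + (∑[ r < n ] indicator (isRep r)) * b
            ≡⟨ cong₂ _+_ (*-distribˡ-sum a edgesOf) (*-distribʳ-sum b (λ r → indicator (isRep r))) ⟩
          ∑[ r < n ] (a * edgesOf r) + ∑[ r < n ] (indicator (isRep r) * b)
            ≡⟨ ∑-distrib-+ (λ r → a * edgesOf r) (λ r → indicator (isRep r) * b) ⟨
          ∑[ r < n ] (a * edgesOf r + indicator (isRep r) * b)
            ≤⟨ ∑-mono-≤ component-bound ⟩
          ∑[ r < n ] (verticesOf r * b)
            ≡⟨ *-distribʳ-sum b verticesOf ⟨
          (∑[ r < n ] verticesOf r) * b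
            ≡⟨ cong (_* b) vertices-partition ⟨
          ∣ V[_] G F ∣ * b ∎))
        where open ≤-Reasoning

  E[⊤]-nonempty : 0 < m → Nonempty (E[_] G ⊤)
  E[⊤]-nonempty (s≤s _) =
    zero , ∈E[ ⊤ ] ([]=⇒lookup (∈⊤ {x = src zero})) ([]=⇒lookup (∈⊤ {x = tgt zero}))

  ∣V[E[S]]∣≤∣S∣ : ∀ S → ∣ V[_] G (E[_] G S) ∣ ≤ ∣ S ∣
  ∣V[E[S]]∣≤∣S∣ S = begin
    ∣ V[_] G (E[_] G S) ∣   ≡⟨ count≡∣∣ (V[_] G (E[_] G S)) ⟨
    count inV               ≤⟨ count-mono endpoint∈S ⟩
    count (lookup S)        ≡⟨ count≡∣∣ S ⟩
    ∣ S ∣                   ∎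
    where
    open ≤-Reasoning
    open Components (E[_] G S)
    endpoint∈S : ∀ v → inV v ≡ true → lookup S v ≡ true
    endpoint∈S v v∈V with inV-true⁻ v∈V
    ... | e , e∈E , end with trans (sym (lookup∘tabulate _ e)) e∈E
    ...   | both with end
    ...     | inj₁ refl = ∧-trueˡ _ both
    ...     | inj₂ refl = ∧-trueʳ (lookup S (src e)) both

lemma4 : (G : Graph) → 0 < Graph.m G →
  ∃ λ (q : ℚᵘ) →
    IsMin (λ (S : Subset (Graph.n G)) → Nonempty (E[_] G S))
          (λ S → frac (∣ S ∣ ∸ 1) ∣ E[_] G S ∣) q
    × IsMin (λ (F : Subset (Graph.m G)) → Nonempty F)
          (λ F → frac (∣ V[_] G F ∣ ∸ c[_] G F) ∣ F ∣) q
lemma4 G 0<m with argmin-Subset ≤-totalPreorder (Graph.n G) (λ S → Nonempty (E[_] G S))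
                    (λ S → nonempty? (E[_] G S)) (λ S → frac (∣ S ∣ ∸ 1) ∣ E[_] G S ∣)
... | inj₁ none = ⊥-elim (none ⊤ (E[⊤]-nonempty G 0<m))
... | inj₂ (S* , S*-spans , minimal) =
  q , ((S* , S*-spans , ≃ℚ-refl) , minimal)
    , ((E[_] G S* , S*-spans , ≤ℚ-antisym E[S*]-ratio≤q (q≤ratio S*-spans)) , λ F → q≤ratio)
  where
  a b : ℕ
  a = ∣ S* ∣ ∸ 1
  b = ∣ E[_] G S* ∣
  q : ℚᵘ
  q = frac a b
  b>0 : 0 < b
  b>0 = nonempty⇒∣p∣>0 S*-spans
  sparse : ∀ S → Nonempty (E[_] G S) → a * ∣ E[_] G S ∣ ≤ (∣ S ∣ ∸ 1) * b
  sparse S S-spans = frac≤frac⇒*≤* b>0 (nonempty⇒∣p∣>0 S-spans) (minimal S S-spans)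
  q≤ratio : ∀ {F} → Nonempty F → q ≤ℚ frac (∣ V[_] G F ∣ ∸ c[_] G F) ∣ F ∣
  q≤ratio {F} F≢∅ = *≤*⇒frac≤frac b>0 (nonempty⇒∣p∣>0 F≢∅) (Components.density-bound G F a b sparse)
  E[S*]-ratio≤q : frac (∣ V[_] G (E[_] G S*) ∣ ∸ c[_] G (E[_] G S*)) b ≤ℚ q
  E[S*]-ratio≤q = *≤*⇒frac≤frac b>0 b>0
    (*-monoˡ-≤ b (∸-mono (∣V[E[S]]∣≤∣S∣ G S*) (Components.c>0 G (E[_] G S*) S*-spans)))
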